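{- Let $G$ be a graph without isolated vertices and let $T$ be a solution counting decision tree for $\varphi(G)$. Let $u$ be a vertex of $T$ labelled by a variable, and let $S\subseteq V(G)$ be such that no two elements of $S$ are adjacent or have a common neighbour, and no element of $S$ is forced to $1$ by $A_u$. Then $\mathrm{weight}(\mathbf{P}^u(S))\le \alpha^u(S)$.
   Context: $\varphi(G)$ is the CNF with variables $V(G)$ and clauses $(a\vee b)$ for $\{a,b\}\in E(G)$. Boolean functions are identified with their sets of satisfying assignments (sets of literals); $|\cdot|$ counts them. For a set of literals $S$, $F|_S$ is the function on $Var(F)\setminus Var(S)$ whose satisfying assignments are those $S'$ with $S\cup S'$ satisfying $F$. A decision tree for $F$ (not constant zero): label the root with some $x\in Var(F)$; for each literal $\ell$ of $x$ occurring in some satisfying assignment of $F$, add an outgoing edge labelled $\ell$ whose head is a leaf if $|Var(F)|=1$ and otherwise roots a decision tree for $F|_\ell$. In a solution counting decision tree (SCDT), the edge labelled $\ell$ leaving node $v$ has weight $|F|_{A_v\cup\{\ell\}}|/|F|_{A_v}|$, where $A_v$ is the set of literals on the root-$v$ path. For a path $P$, $A(P)$ is its set of literals; the weight of a path is the product of its edge weights, and the weight of a set of paths is the sum of their weights. A vertex $y$ is forced to $1$ by $A_u$ if some neighbour of $y$ occurs negatively in $A_u$; $N^u(y)$ is the set of neighbours of $y$ neither assigned by $A_u$ nor forced to $1$ by $A_u$. For $d\ge0$, $c_d=1-2^{ -(2d+1)}$, and $\alpha^u(S)=\prod_{y\in S}c_{|N^u(y)|}$. $\mathbf{P}^u(S)$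 is the set of paths of $T$ from $u$ to a leaf with $S\subseteq A(P)$ (every element of $S$ occurring positively on $P$). -}

module Defs where

open import Data.Bool using (Bool; true; false; _∧_; _∨_; not; if_then_else_)
open import Data.Nat as ℕ using (ℕ; zero; suc)
open import Data.Fin using (Fin; _≟_)
open import Data.Maybe using (Maybe; just; nothing)
open import Data.Product using (Σ; _×_; _,_; ∃)
open import Data.List using (List; []; _∷_; _++_; map; allFin; foldr; concatMap)
open import Data.Bool.ListAction using (all; any)
open import Data.Vec using (Vec; []; _∷_; lookup)
open import Data.Integer using (+_)
open import Data.Rational using (ℚ; _/_; 0ℚ; 1ℚ; ½; _+_; _*_; _-_)
open import Relation.Nullary.Decidable using (⌊_⌋)
open import Relation.Binary.PropositionalEquality using (_≡_; _≢_)
open import Relation.Nullary using (¬_)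

record Graph (n : ℕ) : Set where
  field
    adj     : Fin n → Fin n → Bool
    adj-sym : ∀ x y → adj x y ≡ adj y x
    adj-irr : ∀ x → adj x x ≡ false

open Graph public

Adj : ∀ {n} → Graph n → Fin n → Fin n → Set
Adj G x y = adj G x y ≡ true

NoIsolated : ∀ {n} → Graph n → Set
NoIsolated {n} G = ∀ (x : Fin n) → ∃ λ y → Adj G x y

Assignment : ℕ → Set
Assignment n = Vec Bool n

allAssignments : (n : ℕ) → List (Assignment n)
allAssignments zero = [] ∷ []
allAssignments (suc n) =
  concatMap (λ v → (false ∷ v) ∷ (true ∷ v) ∷ []) (allAssignments n)

satφ : ∀ {n} → Graph n → Assignment n → Bool
satφ {n} G σ =
  all (λ a → all (λ b → not (adj G a b) ∨ (lookup σ a ∨ lookup σ b)) (allFin n)) (allFin n)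

-- A consistent set of literals = partial assignment
PartialAssignment : ℕ → Set
PartialAssignment n = Fin n → Maybe Bool

∅ : ∀ {n} → PartialAssignment n
∅ _ = nothing

_[_↦_] : ∀ {n} → PartialAssignment n → Fin n → Bool → PartialAssignment n
(A [ x ↦ b ]) i = if ⌊ i ≟ x ⌋ then just b else A i

Assigned : ∀ {n} → PartialAssignment n → Fin n → Set
Assigned A x = ∃ λ b → A x ≡ just b

Total : ∀ {n} → PartialAssignment n → Set
Total A = ∀ x → Assigned A x

_==B_ : Bool → Bool → Bool
true ==B b = b
false ==B b = not b

extendsᵇ : ∀ {n} → PartialAssignment n → Assignment n → Bool
extendsᵇ {n} A σ = all (λ i → agree (A i) (lookup σ i)) (allFin n)
  where
  agree : Maybe Bool → Bool → Bool
  agree nothing  _ = true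
  agree (just b) c = b ==B c

-- |φ(G)|_A| : number of satisfying assignments of φ(G) restricted by A
-- (= number of satisfying total assignments of φ(G) extending A)
count : ∀ {n} → Graph n → PartialAssignment n → ℕ
count {n} G A =
  foldr (λ σ k → if satφ G σ ∧ extendsᵇ A σ then suc k else k) 0 (allAssignments n)

data DTree (n : ℕ) : Set where
  leaf : DTree n
  -- node x c₀ c₁ : labelled by x; c₀ is the child along literal ¬x, c₁ along x
  node : Fin n → Maybe (DTree n) → Maybe (DTree n) → DTree n

child : ∀ {n} → Bool → Maybe (DTree n) → Maybe (DTree n) → Maybe (DTree n)
child false c₀ c₁ = c₀
child true  c₀ c₁ = c₁

-- IsDT G A t : t is a decision tree for φ(G)|_A (leaves exactly when
-- no variable is left; edges exactly for literals occurring in some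
-- satisfying assignment of φ(G)|_A).
mutual
  data IsDT {n} (G : Graph n) (A : PartialAssignment n) : DTree n → Set where
    leaf : Total A → IsDT G A leaf
    node : ∀ {x c₀ c₁} → A x ≡ nothing →
           ChildOK G A x false c₀ → ChildOK G A x true c₁ →
           IsDT G A (node x c₀ c₁)

  data ChildOK {n} (G : Graph n) (A : PartialAssignment n) (x : Fin n) (b : Bool)
       : Maybe (DTree n) → Set where
    absent  : count G (A [ x ↦ b ]) ≡ 0 → ChildOK G A x b nothing
    present : ∀ {t} → 0 ℕ.< count G (A [ x ↦ b ]) → IsDT G (A [ x ↦ b ]) t →
              ChildOK G A x b (just t)

IsDecisionTree : ∀ {n} → Graph n → DTree n → Set
IsDecisionTree G T = IsDT G ∅ T × (∃ λ x → ∃ λ c₀ → ∃ λ c₁ → T ≡ node x c₀ c₁)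

-- Reach A t A' u : u is a vertex of the tree t (whose root has path
-- literals A), and A' = A_u is the set of literals on the path to u.
data Reach {n} : PartialAssignment n → DTree n → PartialAssignment n → DTree n → Set where
  here : ∀ {A t} → Reach A t A t
  step : ∀ {A x c₀ c₁ A' u t} (b : Bool) → child b c₀ c₁ ≡ just t →
         Reach (A [ x ↦ b ]) t A' u → Reach A (node x c₀ c₁) A' u

IsNode : ∀ {n} → DTree n → Set
IsNode {n} t = ∃ λ (x : Fin n) → ∃ λ c₀ → ∃ λ c₁ → t ≡ node x c₀ c₁

Literal : ℕ → Set
Literal n = Fin n × Bool

mutual
  leafPaths : ∀ {n} → DTree n → List (List (Literal n))
  leafPaths leaf = [] ∷ []
  leafPaths (node x c₀ c₁) = childPaths x false c₀ ++ childPaths x true c₁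

  childPaths : ∀ {n} → Fin n → Bool → Maybe (DTree n) → List (List (Literal n))
  childPaths x b nothing  = []
  childPaths x b (just t) = map ((x , b) ∷_) (leafPaths t)

-- a / b as a rational (only used with b > 0 in valid trees)
ratio : ℕ → ℕ → ℚ
ratio a zero    = 0ℚ
ratio a (suc b) = (+ a) / suc b

pathWeight : ∀ {n} → Graph n → PartialAssignment n → List (Literal n) → ℚ
pathWeight G A [] = 1ℚ
pathWeight G A ((x , b) ∷ P) =
  ratio (count G (A [ x ↦ b ])) (count G A) * pathWeight G (A [ x ↦ b ]) P

sumℚ : List ℚ → ℚ
sumℚ = foldr _+_ 0ℚ

VSet : ℕ → Set
VSet n = Fin n → Bool

_∈S_ : ∀ {n} → Fin n → VSet n → Set
y ∈S S = S y ≡ true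

positiveOnᵇ : ∀ {n} → VSet n → List (Literal n) → Bool
positiveOnᵇ {n} S P =
  all (λ y → not (S y) ∨ any (λ ℓ → ⌊ Data.Product.proj₁ ℓ ≟ y ⌋ ∧ Data.Product.proj₂ ℓ) P)
      (allFin n)

filterᵇ : ∀ {a} {X : Set a} → (X → Bool) → List X → List X
filterᵇ p [] = []
filterᵇ p (x ∷ xs) = if p x then x ∷ filterᵇ p xs else filterᵇ p xs

-- weight(P^u(S)) for the vertex u (subtree t, path literals A)
weightP : ∀ {n} → Graph n → PartialAssignment n → DTree n → VSet n → ℚ
weightP G A t S = sumℚ (map (pathWeight G A) (filterᵇ (positiveOnᵇ S) (leafPaths t)))

Forced : ∀ {n} → Graph n → PartialAssignment n → Fin n → Set
Forced G A y = ∃ λ z → Adj G y z × A z ≡ just false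

forcedᵇ : ∀ {n} → Graph n → PartialAssignment n → Fin n → Bool
forcedᵇ {n} G A y = any (λ z → adj G y z ∧ isFalse (A z)) (allFin n)
  where
  isFalse : Maybe Bool → Bool
  isFalse (just false) = true
  isFalse _            = false

unassignedᵇ : Maybe Bool → Bool
unassignedᵇ nothing  = true
unassignedᵇ (just _) = false

countᵇ : ∀ {n} → (Fin n → Bool) → ℕ
countᵇ {n} p = foldr (λ i k → if p i then suc k else k) 0 (allFin n)

Nsize : ∀ {n} → Graph n → PartialAssignment n → Fin n → ℕ
Nsize G A y = countᵇ (λ z → adj G y z ∧ unassignedᵇ (A z) ∧ not (forcedᵇ G A z))

powℚ : ℚ → ℕ → ℚ
powℚ q zero    = 1ℚ
powℚ q (suc k) = q * powℚ q k

c : ℕ → ℚ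
c d = 1ℚ - powℚ ½ (suc (2 ℕ.* d))

α : ∀ {n} → Graph n → PartialAssignment n → VSet n → ℚ
α {n} G A S = foldr (λ y q → if S y then c (Nsize G A y) * q else q) 1ℚ (allFin n)

Scattered : ∀ {n} → Graph n → VSet n → Set
Scattered G S = ∀ y z → y ∈S S → z ∈S S → y ≢ z →
  ¬ Adj G y z × ¬ (∃ λ w → Adj G y w × Adj G w z)

module Submission where

-- Write #X for the number of solutions of φ(G) extending A_u that satisfy X.  The proof
-- has two independent halves, joined in theorem6 at the end of the file.
--
-- In an SCDT the weights telescope: the paths below a vertex with
--     literals A that meet S positively weigh at most #(S ≡ 1) / #(true), where the
--     numerator is taken to be 0 when S meets dom A.  Induction on the tree: at a node
--     the two children split the parent's solutions according to the label's value.
-- (2) Peeling bound.  For y ∉ dom A, not forced, with d = |N^A(y)|, the map "set y to 0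
--     and N^A(y) to 1" sends solutions with y = 1 to solutions with y = 0 (every other
--     neighbour of y is already 1) and is at most 2^d-to-one.  Hence
--     #(y = 1 ∧ R) ≤ 2^d #(y = 0 ∧ R), and so (as 2^d + 1 ≤ 2^(2d+1)) #(y = 1 ∧ R) ≤ c_d #(R),
--     for every event R ignoring N^A(y) ∪ {y}.  Since S is scattered, "the rest of S is 1" is such an
--     event, and peeling S one vertex at a time gives #(S ≡ 1) ≤ α^A(S) #(true).

open import Defs
open import Data.Nat using (ℕ)
open import Data.Rational using (_≤_)
open import Relation.Nullary using (¬_)

open import Data.Bool using (Bool; true; false; _∧_; _∨_; not; if_then_else_)
import Data.Bool.Properties as BoolP
open import Data.Bool.ListAction using (all; any)
open import Data.Nat as ℕ using (zero; suc)
import Data.Nat.Properties as ℕP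
open import Data.Nat.Tactic.RingSolver using (solve-∀)
open import Data.Integer as ℤ using (+_)
import Data.Integer.Properties as ℤP
open import Data.Integer.Tactic.RingSolver using () renaming (solve-∀ to ℤ-solve)
open import Data.Rational using (ℚ; _/_; _+_; _*_; _-_; -_; 0ℚ; 1ℚ; ½; toℚᵘ; *≤*; Positive; nonNegative)
import Data.Rational.Properties as ℚP
import Data.Rational.Unnormalised as ℚᵘ
import Data.Rational.Unnormalised.Properties as ℚᵘP
open import Data.Rational.Solver using (module +-*-Solver)
open import Data.Fin as Fin using (Fin; _≟_)
open import Data.Maybe using (Maybe; just; nothing)
open import Data.Product using (_×_; _,_; ∃; proj₁)
open import Data.Sum using (_⊎_; inj₁; inj₂)
open import Data.List using (List; []; _∷_; _++_; map; allFin; foldr; concatMap)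
import Data.List.Properties as ListP
open import Data.List.Membership.Propositional using (_∈_)
open import Data.List.Membership.Propositional.Properties using (∈-allFin)
open import Data.List.Relation.Unary.Any using (here; there)
open import Data.List.Relation.Unary.All as All using ()
open import Data.List.Relation.Unary.AllPairs using (_∷_)
open import Data.List.Relation.Unary.Unique.Propositional using (Unique)
open import Data.List.Relation.Unary.Unique.Propositional.Properties using (allFin⁺)
open import Data.Vec using ([]; _∷_; lookup)
open import Data.Empty using (⊥; ⊥-elim)
open import Relation.Nullary.Decidable using (⌊_⌋; yes; no)
open import Relation.Binary.PropositionalEquality

∧-true₁ : ∀ {a b} → a ∧ b ≡ true → a ≡ true
∧-true₁ {true} _ = refl

∧-true₂ : ∀ {a b} → a ∧ b ≡ true → b ≡ true
∧-true₂ {true} p = p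

∧-true : ∀ {a b} → a ≡ true → b ≡ true → a ∧ b ≡ true
∧-true refl refl = refl

∨-true-elim : ∀ {a b} → a ∨ b ≡ true → a ≡ true ⊎ b ≡ true
∨-true-elim {true} _ = inj₁ refl
∨-true-elim {false} p = inj₂ p

∨-trueˡ : ∀ {a} b → a ≡ true → a ∨ b ≡ true
∨-trueˡ b refl = refl

∨-trueʳ : ∀ a {b} → b ≡ true → a ∨ b ≡ true
∨-trueʳ true _ = refl
∨-trueʳ false p = p

not-true : ∀ {a} → a ≡ false → not a ≡ true
not-true refl = refl

true≢false : ∀ {a} → a ≡ true → a ≡ false → ⊥
true≢false refl ()

bool-cases : (b : Bool) → b ≡ true ⊎ b ≡ false
bool-cases true = inj₁ refl
bool-cases false = inj₂ refl

-- `not s ∨ v` is the Boolean implication s ⇒ v (membership tests in Defs use it).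
⇒-elim : ∀ {s v} → not s ∨ v ≡ true → s ≡ true → v ≡ true
⇒-elim h refl = h

⇒-intro : ∀ s {v} → (s ≡ true → v ≡ true) → not s ∨ v ≡ true
⇒-intro true h = h refl
⇒-intro false h = refl

all-elim : ∀ {a} {X : Set a} (p : X → Bool) {xs : List X} {x} →
  all p xs ≡ true → x ∈ xs → p x ≡ true
all-elim p {_ ∷ xs} h (here refl) = ∧-true₁ h
all-elim p {_ ∷ xs} h (there m) = all-elim p {xs} (∧-true₂ h) m

all-intro : ∀ {a} {X : Set a} (p : X → Bool) (xs : List X) →
  (∀ x → x ∈ xs → p x ≡ true) → all p xs ≡ true
all-intro p [] h = refl
all-intro p (x ∷ xs) h = ∧-true (h x (here refl)) (all-intro p xs (λ y m → h y (there m)))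

all-cong : ∀ {a} {X : Set a} (f g : X → Bool) xs → (∀ x → f x ≡ g x) → all f xs ≡ all g xs
all-cong f g [] h = refl
all-cong f g (x ∷ xs) h = cong₂ _∧_ (h x) (all-cong f g xs h)

allFin-elim : ∀ {n} (p : Fin n → Bool) → all p (allFin n) ≡ true → ∀ x → p x ≡ true
allFin-elim p h x = all-elim p h (∈-allFin x)

allFin-intro : ∀ {n} (p : Fin n → Bool) → (∀ x → p x ≡ true) → all p (allFin n) ≡ true
allFin-intro {n} p h = all-intro p (allFin n) (λ x _ → h x)

any-elim : ∀ {a} {X : Set a} (p : X → Bool) (xs : List X) → any p xs ≡ true → ∃ λ x → p x ≡ true
any-elim p (x ∷ xs) h with ∨-true-elim {p x} h
... | inj₁ q = x , q
... | inj₂ q = any-elim p xs q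

countL : ∀ {a} {X : Set a} → (X → Bool) → List X → ℕ
countL p = foldr (λ x k → if p x then suc k else k) 0

# : ∀ {n} → (Assignment n → Bool) → ℕ
# {zero} p = if p [] then 1 else 0
# {suc n} p = # (λ v → p (false ∷ v)) ℕ.+ # (λ v → p (true ∷ v))

countL-allAssignments : ∀ {n} (p : Assignment n → Bool) → countL p (allAssignments n) ≡ # p
countL-allAssignments {zero} p with p []
... | true = refl
... | false = refl
countL-allAssignments {suc n} p =
  trans (split (allAssignments n))
        (cong₂ ℕ._+_ (countL-allAssignments (λ v → p (false ∷ v)))
                     (countL-allAssignments (λ v → p (true ∷ v))))
  where
  pair : Assignment n → List (Assignment (suc n))
  pair v = (false ∷ v) ∷ (true ∷ v) ∷ []
  split : ∀ vs → countL p (concatMap pair vs) ≡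
    countL (λ v → p (false ∷ v)) vs ℕ.+ countL (λ v → p (true ∷ v)) vs
  split [] = refl
  split (v ∷ vs) with p (false ∷ v) | p (true ∷ v) | split vs
  ... | false | false | ih = ih
  ... | true  | false | ih = cong suc ih
  ... | false | true  | ih = trans (cong suc ih) (sym (ℕP.+-suc _ _))
  ... | true  | true  | ih = cong suc (trans (cong suc ih) (sym (ℕP.+-suc _ _)))

#-cong : ∀ {n} (p q : Assignment n → Bool) → (∀ σ → p σ ≡ q σ) → # p ≡ # q
#-cong {zero} p q h rewrite h [] = refl
#-cong {suc n} p q h =
  cong₂ ℕ._+_ (#-cong _ _ (λ v → h (false ∷ v))) (#-cong _ _ (λ v → h (true ∷ v)))

#-mono : ∀ {n} (p q : Assignment n → Bool) → (∀ σ → p σ ≡ true → q σ ≡ true) → # p ℕ.≤ # q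
#-mono {zero} p q h with p [] in e
... | false = ℕ.z≤n
... | true rewrite h [] e = ℕ.s≤s ℕ.z≤n
#-mono {suc n} p q h =
  ℕP.+-mono-≤ (#-mono _ _ (λ v → h (false ∷ v))) (#-mono _ _ (λ v → h (true ∷ v)))

#-false : ∀ {n} → # {n} (λ _ → false) ≡ 0
#-false {zero} = refl
#-false {suc n} = cong₂ ℕ._+_ (#-false {n}) (#-false {n})

#-split : ∀ {n} (p q : Assignment n → Bool) →
  # p ≡ # (λ σ → p σ ∧ q σ) ℕ.+ # (λ σ → p σ ∧ not (q σ))
#-split {zero} p q with p [] | q []
... | false | _ = refl
... | true | false = refl
... | true | true = refl
#-split {suc n} p q
  rewrite #-split (λ v → p (false ∷ v)) (λ v → q (false ∷ v))
        | #-split (λ v → p (true ∷ v)) (λ v → q (true ∷ v)) =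
  swap (# (λ v → p (false ∷ v) ∧ q (false ∷ v))) _ _ _
  where
  swap : ∀ a b c d → (a ℕ.+ b) ℕ.+ (c ℕ.+ d) ≡ (a ℕ.+ c) ℕ.+ (b ℕ.+ d)
  swap = solve-∀

-- Toggling one coordinate is an involution of the cube, so it preserves counts.
toggle : ∀ {n} → Fin n → Assignment n → Assignment n
toggle Fin.zero (b ∷ v) = not b ∷ v
toggle (Fin.suc z) (b ∷ v) = b ∷ toggle z v

#-toggle : ∀ {n} (z : Fin n) (p : Assignment n → Bool) → # (λ σ → p (toggle z σ)) ≡ # p
#-toggle {suc n} Fin.zero p = ℕP.+-comm (# (λ v → p (true ∷ v))) _
#-toggle {suc n} (Fin.suc z) p =
  cong₂ ℕ._+_ (#-toggle z (λ v → p (false ∷ v))) (#-toggle z (λ v → p (true ∷ v)))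

toggle-same : ∀ {n} (z : Fin n) σ → lookup (toggle z σ) z ≡ not (lookup σ z)
toggle-same Fin.zero (b ∷ σ) = refl
toggle-same (Fin.suc z) (b ∷ σ) = toggle-same z σ

toggle-other : ∀ {n} (z i : Fin n) σ → i ≢ z → lookup (toggle z σ) i ≡ lookup σ i
toggle-other Fin.zero Fin.zero σ ne = ⊥-elim (ne refl)
toggle-other Fin.zero (Fin.suc i) (b ∷ σ) ne = refl
toggle-other (Fin.suc z) Fin.zero (b ∷ σ) ne = refl
toggle-other (Fin.suc z) (Fin.suc i) (b ∷ σ) ne = toggle-other z i σ (λ e → ne (cong Fin.suc e))

Sol : ∀ {n} → Graph n → PartialAssignment n → Assignment n → Bool
Sol G A σ = satφ G σ ∧ extendsᵇ A σ

count≡#Sol : ∀ {n} (G : Graph n) A → count G A ≡ # (Sol G A)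
count≡#Sol G A = countL-allAssignments (Sol G A)

satφ-elim : ∀ {n} (G : Graph n) σ → satφ G σ ≡ true →
  ∀ a b → Adj G a b → lookup σ a ∨ lookup σ b ≡ true
satφ-elim G σ h a b ab with allFin-elim _ (allFin-elim _ h a) b
... | clause rewrite ab = clause

satφ-intro : ∀ {n} (G : Graph n) σ →
  (∀ a b → Adj G a b → lookup σ a ∨ lookup σ b ≡ true) → satφ G σ ≡ true
satφ-intro G σ h = allFin-intro _ (λ a → allFin-intro _ (λ b → clause a b (adj G a b) refl))
  where
  clause : ∀ a b e → adj G a b ≡ e → not e ∨ (lookup σ a ∨ lookup σ b) ≡ true
  clause a b false _ = refl
  clause a b true ab = h a b ab

-- The coordinatewise test of `extendsᵇ`, obtained as its one-variable instance
-- (the test itself is local to Defs); it reduces to the local test conjoined with true.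
agreesᵇ : Maybe Bool → Bool → Bool
agreesᵇ m c = extendsᵇ {1} (λ _ → m) (c ∷ [])

agreesᵇ-intro : ∀ m c → (∀ b → m ≡ just b → c ≡ b) → agreesᵇ m c ≡ true
agreesᵇ-intro nothing c h = refl
agreesᵇ-intro (just true) c h rewrite h true refl = refl
agreesᵇ-intro (just false) c h rewrite h false refl = refl

agreesᵇ-elim : ∀ m c → agreesᵇ m c ≡ true → ∀ b → m ≡ just b → c ≡ b
agreesᵇ-elim (just true) true _ _ refl = refl
agreesᵇ-elim (just false) false _ _ refl = refl

extends-elim : ∀ {n} (A : PartialAssignment n) σ → extendsᵇ A σ ≡ true →
  ∀ i b → A i ≡ just b → lookup σ i ≡ b
extends-elim A σ h i = agreesᵇ-elim (A i) (lookup σ i) (∧-true (allFin-elim _ h i) refl)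

extends-intro : ∀ {n} (A : PartialAssignment n) σ →
  (∀ i b → A i ≡ just b → lookup σ i ≡ b) → extendsᵇ A σ ≡ true
extends-intro A σ h = allFin-intro _ (λ i → ∧-true₁ (agreesᵇ-intro (A i) (lookup σ i) (h i)))

forced-elim : ∀ {n} (G : Graph n) A z → forcedᵇ G A z ≡ true → Forced G A z
forced-elim {n} G A z h with any-elim _ (allFin n) h
... | w , q with A w in e | q
...   | just false | q' = w , ∧-true₁ q' , e
...   | just true  | q' = ⊥-elim (true≢false q' (BoolP.∧-zeroʳ (adj G z w)))
...   | nothing    | q' = ⊥-elim (true≢false q' (BoolP.∧-zeroʳ (adj G z w)))

update-same : ∀ {n} (A : PartialAssignment n) x b → (A [ x ↦ b ]) x ≡ just b
update-same A x b with x ≟ x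
... | yes _ = refl
... | no ne = ⊥-elim (ne refl)

update-other : ∀ {n} (A : PartialAssignment n) x b i → i ≢ x → (A [ x ↦ b ]) i ≡ A i
update-other A x b i ne with i ≟ x
... | yes e = ⊥-elim (ne e)
... | no _ = refl

-- Pushing coordinate z to 1: the assignments with z = 1 that agree off z with some
-- assignment satisfying q.  At most two q-assignments collapse onto one image.
pushTo1 : ∀ {n} → Fin n → (Assignment n → Bool) → Assignment n → Bool
pushTo1 z q σ = (q σ ∨ q (toggle z σ)) ∧ lookup σ z

-- Split q by the value of z; after toggling z, both halves land in pushTo1 z q.
#-pushTo1 : ∀ {n} (z : Fin n) q → # q ℕ.≤ 2 ℕ.* # (pushTo1 z q)
#-pushTo1 z q = begin
    # q
  ≡⟨ #-split q (λ σ → lookup σ z) ⟩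
    # (λ σ → q σ ∧ lookup σ z) ℕ.+ # (λ σ → q σ ∧ not (lookup σ z))
  ≡⟨ cong (# (λ σ → q σ ∧ lookup σ z) ℕ.+_) (sym (#-toggle z (λ σ → q σ ∧ not (lookup σ z)))) ⟩
    # (λ σ → q σ ∧ lookup σ z) ℕ.+ # (λ σ → q (toggle z σ) ∧ not (lookup (toggle z σ) z))
  ≤⟨ ℕP.+-mono-≤ (#-mono _ _ kept) (#-mono _ _ toggled) ⟩
    # (pushTo1 z q) ℕ.+ # (pushTo1 z q)
  ≡⟨ cong (# (pushTo1 z q) ℕ.+_) (sym (ℕP.+-identityʳ _)) ⟩
    2 ℕ.* # (pushTo1 z q)
  ∎
  where
  open ℕP.≤-Reasoning
  kept : ∀ σ → q σ ∧ lookup σ z ≡ true → pushTo1 z q σ ≡ true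
  kept σ e = ∧-true (∨-trueˡ _ (∧-true₁ {q σ} e)) (∧-true₂ {q σ} e)
  toggled : ∀ σ → q (toggle z σ) ∧ not (lookup (toggle z σ) z) ≡ true → pushTo1 z q σ ≡ true
  toggled σ e = ∧-true (∨-trueʳ (q σ) (∧-true₁ {q (toggle z σ)} e))
    (trans (sym (BoolP.not-involutive _))
           (trans (cong not (sym (toggle-same z σ))) (∧-true₂ {q (toggle z σ)} e)))

pushAll : ∀ {n} → (Fin n → Bool) → List (Fin n) → (Assignment n → Bool) → Assignment n → Bool
pushAll N [] q = q
pushAll N (z ∷ zs) q = if N z then pushTo1 z (pushAll N zs q) else pushAll N zs q

#-pushAll : ∀ {n} (N : Fin n → Bool) zs q → # q ℕ.≤ 2 ℕ.^ countL N zs ℕ.* # (pushAll N zs q)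
#-pushAll N [] q = ℕP.≤-reflexive (sym (ℕP.+-identityʳ _))
#-pushAll N (z ∷ zs) q with N z
... | false = #-pushAll N zs q
... | true = begin
    # q
  ≤⟨ #-pushAll N zs q ⟩
    2 ℕ.^ k ℕ.* # I
  ≤⟨ ℕP.*-monoʳ-≤ (2 ℕ.^ k) (#-pushTo1 z I) ⟩
    2 ℕ.^ k ℕ.* (2 ℕ.* # (pushTo1 z I))
  ≡⟨ reassoc (2 ℕ.^ k) (# (pushTo1 z I)) ⟩
    2 ℕ.* 2 ℕ.^ k ℕ.* # (pushTo1 z I)
  ∎
  where
  open ℕP.≤-Reasoning
  k = countL N zs
  I = pushAll N zs q
  reassoc : ∀ a b → a ℕ.* (2 ℕ.* b) ≡ 2 ℕ.* a ℕ.* b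
  reassoc = solve-∀

record PushedFrom {n} (q : Assignment n → Bool) (N : Fin n → Bool) (zs : List (Fin n))
                  (σ : Assignment n) : Set where
  field
    origin      : Assignment n
    origin-ok   : q origin ≡ true
    origin-off  : ∀ i → N i ≡ false → lookup origin i ≡ lookup σ i
    pushed-one  : ∀ z → z ∈ zs → N z ≡ true → lookup σ z ≡ true

pushAll-sound : ∀ {n} q (N : Fin n → Bool) zs σ → pushAll N zs q σ ≡ true → PushedFrom q N zs σ
pushAll-sound q N [] σ h = record
  { origin = σ ; origin-ok = h ; origin-off = λ _ _ → refl ; pushed-one = λ _ () }
pushAll-sound q N (z ∷ zs) σ h with N z in Nz
... | false = record { PushedFrom ih ; pushed-one = one }
  where
  ih = pushAll-sound q N zs σ h
  one : ∀ z' → z' ∈ z ∷ zs → N z' ≡ true → lookup σ z' ≡ true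
  one z' (here refl) e = ⊥-elim (true≢false e Nz)
  one z' (there m) e = PushedFrom.pushed-one ih z' m e
... | true with ∨-true-elim (∧-true₁ h)
...   | inj₁ h' = record { PushedFrom ih ; pushed-one = one }
  where
  ih = pushAll-sound q N zs σ h'
  one : ∀ z' → z' ∈ z ∷ zs → N z' ≡ true → lookup σ z' ≡ true
  one z' (here refl) e = ∧-true₂ h
  one z' (there m) e = PushedFrom.pushed-one ih z' m e
...   | inj₂ h' = record { origin = origin ; origin-ok = origin-ok ; origin-off = off ; pushed-one = one }
  where
  ih = pushAll-sound q N zs (toggle z σ) h'
  open PushedFrom ih using (origin; origin-ok)
  off : ∀ i → N i ≡ false → lookup origin i ≡ lookup σ i
  off i e with i ≟ z
  ... | yes refl = ⊥-elim (true≢false Nz e)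
  ... | no ne = trans (PushedFrom.origin-off ih i e) (toggle-other z i σ ne)
  one : ∀ z' → z' ∈ z ∷ zs → N z' ≡ true → lookup σ z' ≡ true
  one z' (here refl) e = ∧-true₂ h
  one z' (there m) e with z' ≟ z
  ... | yes refl = ∧-true₂ h
  ... | no ne = trans (sym (toggle-other z z' σ ne)) (PushedFrom.pushed-one ih z' m e)

Nᵇ : ∀ {n} → Graph n → PartialAssignment n → Fin n → Fin n → Bool
Nᵇ G A y z = adj G y z ∧ unassignedᵇ (A z) ∧ not (forcedᵇ G A z)

AgreeOff : ∀ {n} → Graph n → PartialAssignment n → Fin n → Assignment n → Assignment n → Set
AgreeOff G A y τ σ = ∀ i → Nᵇ G A y i ≡ false → i ≢ y → lookup τ i ≡ lookup σ i

-- The switching argument for one unassigned, unforced vertex y: sending a solution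
-- with y = 1 to the assignment with y = 0 and all of N^A(y) set to 1 gives again a
-- solution, and this map is at most 2^|N^A(y)|-to-one.
module Switching {n} (G : Graph n) (A : PartialAssignment n) (y : Fin n)
                 (y-unassigned : A y ≡ nothing) (y-unforced : ¬ Forced G A y) where

  N : Fin n → Bool
  N = Nᵇ G A y

  y∉N : N y ≡ false
  y∉N rewrite adj-irr G y = refl

  assigned∉N : ∀ i b → A i ≡ just b → N i ≡ false
  assigned∉N i b e rewrite e = BoolP.∧-zeroʳ (adj G y i)

  N-≢y : ∀ z → N z ≡ true → z ≢ y
  N-≢y z h refl = true≢false h y∉N

  -- Every neighbour of y outside N^A(y) is 1 in any solution extending A: it is
  -- either set to 1 by A (0 would force y), or forced to 1 by A.
  neighbour-one : ∀ σ → Sol G A σ ≡ true → ∀ b → Adj G y b → N b ≡ false → lookup σ b ≡ true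
  neighbour-one σ sol b yb b∉N with A b in Ab
  ... | just true = extends-elim A σ ext b true Ab
    where ext = ∧-true₂ {satφ G σ} sol
  ... | just false = ⊥-elim (y-unforced (b , yb , Ab))
  ... | nothing with bool-cases (forcedᵇ G A b)
  ...   | inj₂ unforced rewrite yb | unforced = ⊥-elim (true≢false refl b∉N)
  ...   | inj₁ forced with forced-elim G A b forced
  ...     | w , bw , Aw with ∨-true-elim (satφ-elim G σ (∧-true₁ sol) b w bw)
  ...       | inj₁ one = one
  ...       | inj₂ w-one = ⊥-elim (true≢false w-one (extends-elim A σ (∧-true₂ {satφ G σ} sol) w false Aw))

  switch-solution : ∀ σ τ → Sol G A σ ≡ true → AgreeOff G A y τ σ →
    (∀ z → N z ≡ true → lookup τ z ≡ true) → Sol G A τ ≡ true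
  switch-solution σ τ sol off N-one = ∧-true (satφ-intro G τ clause) (extends-intro A τ agrees)
    where
    clause : ∀ a b → Adj G a b → lookup τ a ∨ lookup τ b ≡ true
    clause a b ab with bool-cases (N a) | bool-cases (N b)
    ... | inj₁ a∈N | _ = ∨-trueˡ _ (N-one a a∈N)
    ... | inj₂ _ | inj₁ b∈N = ∨-trueʳ _ (N-one b b∈N)
    ... | inj₂ a∉N | inj₂ b∉N with a ≟ y | b ≟ y
    ...   | yes refl | yes refl = ⊥-elim (true≢false ab (adj-irr G y))
    ...   | yes refl | no b≢y = ∨-trueʳ _ (trans (off b b∉N b≢y) (neighbour-one σ sol b ab b∉N))
    ...   | no a≢y | yes refl =
      ∨-trueˡ _ (trans (off a a∉N a≢y) (neighbour-one σ sol a (trans (adj-sym G y a) ab) a∉N))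
    ...   | no a≢y | no b≢y rewrite off a a∉N a≢y | off b b∉N b≢y = satφ-elim G σ (∧-true₁ sol) a b ab
    agrees : ∀ i b → A i ≡ just b → lookup τ i ≡ b
    agrees i b e with i ≟ y
    ... | yes refl with () ← trans (sym e) y-unassigned
    ... | no i≢y = trans (off i (assigned∉N i b e) i≢y) (extends-elim A σ (∧-true₂ {satφ G σ} sol) i b e)

  switching-bound : (R : Assignment n → Bool) → (∀ σ τ → R σ ≡ true → AgreeOff G A y τ σ → R τ ≡ true) →
    # (λ σ → (Sol G A σ ∧ R σ) ∧ lookup σ y) ℕ.≤
    2 ℕ.^ Nsize G A y ℕ.* # (λ σ → (Sol G A σ ∧ R σ) ∧ not (lookup σ y))
  switching-bound R R-ignores = begin
      # p
    ≤⟨ #-pushAll N (allFin n) p ⟩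
      2 ℕ.^ Nsize G A y ℕ.* # I
    ≡⟨ cong (2 ℕ.^ Nsize G A y ℕ.*_) (sym (#-toggle y I)) ⟩
      2 ℕ.^ Nsize G A y ℕ.* # (λ τ → I (toggle y τ))
    ≤⟨ ℕP.*-monoʳ-≤ (2 ℕ.^ Nsize G A y) (#-mono _ _ switched) ⟩
      2 ℕ.^ Nsize G A y ℕ.* # (λ σ → (Sol G A σ ∧ R σ) ∧ not (lookup σ y))
    ∎
    where
    open ℕP.≤-Reasoning
    p : Assignment n → Bool
    p σ = (Sol G A σ ∧ R σ) ∧ lookup σ y
    I : Assignment n → Bool
    I = pushAll N (allFin n) p
    -- the preimage of τ under "toggle y, then push N^A(y)" comes from a p-solution
    switched : ∀ τ → I (toggle y τ) ≡ true → (Sol G A τ ∧ R τ) ∧ not (lookup τ y) ≡ true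
    switched τ h = ∧-true (∧-true (switch-solution σ τ sol off N-one) (R-ignores σ τ Rσ off))
                          (not-true τy)
      where
      open PushedFrom (pushAll-sound p N (allFin n) (toggle y τ) h)
        renaming (origin to σ; origin-ok to pσ)
      sol = ∧-true₁ (∧-true₁ {Sol G A σ ∧ R σ} pσ)
      Rσ = ∧-true₂ {Sol G A σ} (∧-true₁ {Sol G A σ ∧ R σ} pσ)
      off : AgreeOff G A y τ σ
      off i i∉N i≢y = sym (trans (origin-off i i∉N) (toggle-other y i τ i≢y))
      N-one : ∀ z → N z ≡ true → lookup τ z ≡ true
      N-one z z∈N = trans (sym (toggle-other y z τ (N-≢y z z∈N))) (pushed-one z (∈-allFin z) z∈N)
      τy : lookup τ y ≡ false
      τy = trans (sym (BoolP.not-involutive _))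
             (cong not (trans (sym (toggle-same y τ))
                              (trans (sym (origin-off y y∉N)) (∧-true₂ {Sol G A σ ∧ R σ} pσ))))

ι : ℕ → ℚ
ι a = + a / 1

toℚᵘ-/ : ∀ a k → toℚᵘ ((+ a) / suc k) ℚᵘ.≃ ℚᵘ.mkℚᵘ (+ a) k
toℚᵘ-/ a k = ℚP.toℚᵘ-fromℚᵘ (ℚᵘ.mkℚᵘ (+ a) k)

ι-+ : ∀ a b → ι (a ℕ.+ b) ≡ ι a + ι b
ι-+ a b = ℚP.toℚᵘ-injective (ℚᵘP.≃-trans (toℚᵘ-/ (a ℕ.+ b) 0) (ℚᵘP.≃-trans sum
  (ℚᵘP.≃-sym (ℚᵘP.≃-trans (ℚP.toℚᵘ-homo-+ (ι a) (ι b)) (ℚᵘP.+-cong (toℚᵘ-/ a 0) (toℚᵘ-/ b 0))))))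
  where
  sum : ℚᵘ.mkℚᵘ (+ (a ℕ.+ b)) 0 ℚᵘ.≃ (ℚᵘ.mkℚᵘ (+ a) 0 ℚᵘ.+ ℚᵘ.mkℚᵘ (+ b) 0)
  sum = ℚᵘ.*≡* (ring (+ a) (+ b))
    where
    ring : ∀ x y → (x ℤ.+ y) ℤ.* + 1 ≡ (x ℤ.* + 1 ℤ.+ y ℤ.* + 1) ℤ.* + 1
    ring = ℤ-solve

ι-* : ∀ a b → ι (a ℕ.* b) ≡ ι a * ι b
ι-* a b = ℚP.toℚᵘ-injective (ℚᵘP.≃-trans (toℚᵘ-/ (a ℕ.* b) 0) (ℚᵘP.≃-trans product
  (ℚᵘP.≃-sym (ℚᵘP.≃-trans (ℚP.toℚᵘ-homo-* (ι a) (ι b)) (ℚᵘP.*-cong (toℚᵘ-/ a 0) (toℚᵘ-/ b 0))))))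
  where
  product : ℚᵘ.mkℚᵘ (+ (a ℕ.* b)) 0 ℚᵘ.≃ (ℚᵘ.mkℚᵘ (+ a) 0 ℚᵘ.* ℚᵘ.mkℚᵘ (+ b) 0)
  product = ℚᵘ.*≡* (cong (ℤ._* + 1) (ℤP.pos-* a b))

ι-mono : ∀ {a b} → a ℕ.≤ b → ι a ≤ ι b
ι-mono {a} {b} a≤b = ℚP.toℚᵘ-cancel-≤ (ℚᵘP.≤-respʳ-≃ (ℚᵘP.≃-sym (toℚᵘ-/ b 0))
  (ℚᵘP.≤-respˡ-≃ (ℚᵘP.≃-sym (toℚᵘ-/ a 0)) (ℚᵘ.*≤* (ℤP.*-monoʳ-≤-nonNeg (+ 1) (ℤ.+≤+ a≤b)))))

ι-positive : ∀ k → Positive (ι (suc k))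
ι-positive k = ℚP.normalize-pos (suc k) 1

ratio-* : ∀ a k → ratio a (suc k) * ι (suc k) ≡ ι a
ratio-* a k = ℚP.toℚᵘ-injective (ℚᵘP.≃-trans
  (ℚᵘP.≃-trans (ℚP.toℚᵘ-homo-* (ratio a (suc k)) (ι (suc k))) (ℚᵘP.*-cong (toℚᵘ-/ a k) (toℚᵘ-/ (suc k) 0)))
  (ℚᵘP.≃-sym (ℚᵘP.≃-trans (toℚᵘ-/ a 0) cancel)))
  where
  cancel : ℚᵘ.mkℚᵘ (+ a) 0 ℚᵘ.≃ (ℚᵘ.mkℚᵘ (+ a) k ℚᵘ.* ℚᵘ.mkℚᵘ (+ suc k) 0)
  cancel = ℚᵘ.*≡* (trans (cong (+ a ℤ.*_) (ℤP.pos-* (suc k) 1)) (ring (+ a) (+ suc k)))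
    where
    ring : ∀ x y → x ℤ.* (y ℤ.* + 1) ≡ (x ℤ.* y) ℤ.* + 1
    ring = ℤ-solve

cancel-≤ : ∀ k {x y} → x * ι (suc k) ≤ y * ι (suc k) → x ≤ y
cancel-≤ k = ℚP.*-cancelʳ-≤-pos (ι (suc k)) {{ι-positive k}}

cancel-≡ : ∀ k {x y} → x * ι (suc k) ≡ y * ι (suc k) → x ≡ y
cancel-≡ k e = ℚP.≤-antisym (cancel-≤ k (ℚP.≤-reflexive e)) (cancel-≤ k (ℚP.≤-reflexive (sym e)))

ratio-+ : ∀ a b m → ratio a m + ratio b m ≡ ratio (a ℕ.+ b) m
ratio-+ a b zero = ℚP.+-identityʳ 0ℚ
ratio-+ a b (suc k) = cancel-≡ k (begin
    (ratio a (suc k) + ratio b (suc k)) * ι (suc k)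
  ≡⟨ ℚP.*-distribʳ-+ (ι (suc k)) (ratio a (suc k)) (ratio b (suc k)) ⟩
    ratio a (suc k) * ι (suc k) + ratio b (suc k) * ι (suc k)
  ≡⟨ cong₂ _+_ (ratio-* a k) (ratio-* b k) ⟩
    ι a + ι b
  ≡⟨ sym (ι-+ a b) ⟩
    ι (a ℕ.+ b)
  ≡⟨ sym (ratio-* (a ℕ.+ b) k) ⟩
    ratio (a ℕ.+ b) (suc k) * ι (suc k)
  ∎)
  where open ≡-Reasoning

ratio-mono : ∀ {a b} m → a ℕ.≤ b → ratio a m ≤ ratio b m
ratio-mono zero _ = ℚP.≤-refl
ratio-mono {a} {b} (suc k) a≤b =
  cancel-≤ k (subst₂ _≤_ (sym (ratio-* a k)) (sym (ratio-* b k)) (ι-mono a≤b))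

ratio-nonneg : ∀ a m → 0ℚ ≤ ratio a m
ratio-nonneg a m = subst (_≤ ratio a m) (ratio-0 m) (ratio-mono {0} {a} m ℕ.z≤n)
  where
  ratio-0 : ∀ m → ratio 0 m ≡ 0ℚ
  ratio-0 zero = refl
  ratio-0 (suc k) = cancel-≡ k (trans (ratio-* 0 k) (sym (ℚP.*-zeroˡ (ι (suc k)))))

ratio-self : ∀ m → 0 ℕ.< m → ratio m m ≡ 1ℚ
ratio-self (suc k) _ = cancel-≡ k (trans (ratio-* (suc k) k) (sym (ℚP.*-identityˡ (ι (suc k)))))

ratio-telescope : ∀ a b m → 0 ℕ.< b → ratio b m * ratio a b ≡ ratio a m
ratio-telescope a (suc b) zero _ = ℚP.*-zeroˡ (ratio a (suc b))
ratio-telescope a (suc b) (suc k) _ = cancel-≡ k (begin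
    ratio (suc b) (suc k) * ratio a (suc b) * ι (suc k)
  ≡⟨ cong (_* ι (suc k)) (ℚP.*-comm (ratio (suc b) (suc k)) (ratio a (suc b))) ⟩
    ratio a (suc b) * ratio (suc b) (suc k) * ι (suc k)
  ≡⟨ ℚP.*-assoc (ratio a (suc b)) (ratio (suc b) (suc k)) (ι (suc k)) ⟩
    ratio a (suc b) * (ratio (suc b) (suc k) * ι (suc k))
  ≡⟨ cong (ratio a (suc b) *_) (ratio-* (suc b) k) ⟩
    ratio a (suc b) * ι (suc b)
  ≡⟨ ratio-* a b ⟩
    ι a
  ≡⟨ sym (ratio-* a k) ⟩
    ratio a (suc k) * ι (suc k)
  ∎)
  where open ≡-Reasoning

ratio-≤ : ∀ a k q → ι a ≤ q * ι (suc k) → ratio a (suc k) ≤ q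
ratio-≤ a k q h = cancel-≤ k (subst (_≤ q * ι (suc k)) (sym (ratio-* a k)) h)

nonneg-* : ∀ {x y} → 0ℚ ≤ x → 0ℚ ≤ y → 0ℚ ≤ x * y
nonneg-* {x} {y} 0≤x 0≤y = subst (_≤ x * y) (ℚP.*-zeroʳ x) (ℚP.*-monoˡ-≤-nonNeg x {{nonNegative 0≤x}} 0≤y)

powℚ-½ : ∀ k → powℚ ½ k * ι (2 ℕ.^ k) ≡ 1ℚ
powℚ-½ zero = refl
powℚ-½ (suc k) = begin
    ½ * powℚ ½ k * ι (2 ℕ.* 2 ℕ.^ k)
  ≡⟨ cong (½ * powℚ ½ k *_) (ι-* 2 (2 ℕ.^ k)) ⟩
    ½ * powℚ ½ k * (ι 2 * ι (2 ℕ.^ k))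
  ≡⟨ interchange ½ (powℚ ½ k) (ι 2) (ι (2 ℕ.^ k)) ⟩
    (½ * ι 2) * (powℚ ½ k * ι (2 ℕ.^ k))
  ≡⟨ cong (1ℚ *_) (powℚ-½ k) ⟩
    1ℚ
  ∎
  where
  open ≡-Reasoning
  open +-*-Solver
  interchange : ∀ a b x y → a * b * (x * y) ≡ (a * x) * (b * y)
  interchange = solve 4 (λ a b x y → a :* b :* (x :* y) := (a :* x) :* (b :* y)) refl

powℚ-½-nonneg : ∀ k → 0ℚ ≤ powℚ ½ k
powℚ-½-nonneg zero = *≤* (ℤ.+≤+ ℕ.z≤n)
powℚ-½-nonneg (suc k) = nonneg-* {½} (*≤* (ℤ.+≤+ ℕ.z≤n)) (powℚ-½-nonneg k)

powℚ-½-≤1 : ∀ k → powℚ ½ k ≤ 1ℚ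
powℚ-½-≤1 k = begin
    powℚ ½ k
  ≡⟨ sym (ℚP.*-identityʳ _) ⟩
    powℚ ½ k * ι 1
  ≤⟨ ℚP.*-monoˡ-≤-nonNeg (powℚ ½ k) {{nonNegative (powℚ-½-nonneg k)}} (ι-mono (ℕP.m^n>0 2 k)) ⟩
    powℚ ½ k * ι (2 ℕ.^ k)
  ≡⟨ powℚ-½ k ⟩
    1ℚ
  ∎
  where open ℚP.≤-Reasoning

c-nonneg : ∀ d → 0ℚ ≤ c d
c-nonneg d = subst (_≤ c d) (ℚP.+-inverseʳ (powℚ ½ k)) (ℚP.+-monoˡ-≤ (- powℚ ½ k) (powℚ-½-≤1 k))
  where k = suc (2 ℕ.* d)

≤-2^[2d+1] : ∀ a b d → a ℕ.≤ 2 ℕ.^ d ℕ.* b → a ℕ.+ b ℕ.≤ 2 ℕ.^ suc (2 ℕ.* d) ℕ.* b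
≤-2^[2d+1] a b d h = begin
    a ℕ.+ b
  ≤⟨ ℕP.+-monoˡ-≤ b h ⟩
    2 ℕ.^ d ℕ.* b ℕ.+ b
  ≡⟨ cong (2 ℕ.^ d ℕ.* b ℕ.+_) (sym (ℕP.*-identityˡ b)) ⟩
    2 ℕ.^ d ℕ.* b ℕ.+ 1 ℕ.* b
  ≡⟨ sym (ℕP.*-distribʳ-+ b (2 ℕ.^ d) 1) ⟩
    (2 ℕ.^ d ℕ.+ 1) ℕ.* b
  ≤⟨ ℕP.*-monoˡ-≤ b (ℕP.+-mono-≤ (ℕP.^-monoʳ-≤ 2 (ℕP.m≤m+n d (d ℕ.+ 0))) (ℕP.m^n>0 2 (2 ℕ.* d))) ⟩
    (2 ℕ.^ (2 ℕ.* d) ℕ.+ 2 ℕ.^ (2 ℕ.* d)) ℕ.* b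
  ≡⟨ cong (λ t → (2 ℕ.^ (2 ℕ.* d) ℕ.+ t) ℕ.* b) (sym (ℕP.+-identityʳ _)) ⟩
    2 ℕ.^ suc (2 ℕ.* d) ℕ.* b
  ∎
  where open ℕP.≤-Reasoning

c-bound : ∀ a b d → a ℕ.≤ 2 ℕ.^ d ℕ.* b → ι a ≤ c d * ι (a ℕ.+ b)
c-bound a b d a≤ = begin
    ι a
  ≡⟨ sym (cancel-+ (ι a) (ι b)) ⟩
    ι a + ι b - ι b
  ≡⟨ cong (_- ι b) (sym (ι-+ a b)) ⟩
    s - ι b
  ≤⟨ ℚP.+-monoʳ-≤ s (ℚP.neg-antimono-≤ ε·s≤b) ⟩
    s - ε * s
  ≡⟨ sym (distrib ε s) ⟩
    c d * s
  ∎
  where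
  open ℚP.≤-Reasoning
  open +-*-Solver
  K = 2 ℕ.^ suc (2 ℕ.* d)
  ε = powℚ ½ (suc (2 ℕ.* d))
  s = ι (a ℕ.+ b)
  cancel-+ : ∀ x y → x + y - y ≡ x
  cancel-+ = solve 2 (λ x y → x :+ y :- y := x) refl
  distrib : ∀ x y → (1ℚ - x) * y ≡ y - x * y
  distrib = solve 2 (λ x y → (con 1ℚ :- x) :* y := y :- x :* y) refl
  ε·s≤b : ε * s ≤ ι b
  ε·s≤b = begin
      ε * s
    ≤⟨ ℚP.*-monoˡ-≤-nonNeg ε {{nonNegative (powℚ-½-nonneg (suc (2 ℕ.* d)))}} (ι-mono (≤-2^[2d+1] a b d a≤)) ⟩
      ε * ι (K ℕ.* b)
    ≡⟨ cong (ε *_) (ι-* K b) ⟩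
      ε * (ι K * ι b)
    ≡⟨ sym (ℚP.*-assoc ε (ι K) (ι b)) ⟩
      ε * ι K * ι b
    ≡⟨ cong (_* ι b) (powℚ-½ (suc (2 ℕ.* d))) ⟩
      1ℚ * ι b
    ≡⟨ ℚP.*-identityˡ (ι b) ⟩
      ι b
    ∎

allOneᵇ : ∀ {n} → VSet n → Assignment n → Bool
allOneᵇ {n} S σ = all (λ y → not (S y) ∨ lookup σ y) (allFin n)

unassignedOnᵇ : ∀ {n} → PartialAssignment n → VSet n → Bool
unassignedOnᵇ {n} A S = all (λ y → not (S y) ∨ unassignedᵇ (A y)) (allFin n)

-- The solutions extending A that set S to 1, provided S is disjoint from dom A
-- (otherwise none: no path below A can then contain all of S positively).
Hit : ∀ {n} → Graph n → PartialAssignment n → VSet n → Assignment n → Bool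
Hit G A S σ = (Sol G A σ ∧ allOneᵇ S σ) ∧ unassignedOnᵇ A S

-- What remains of S to be met positively after an edge labelled by the literal (x , b).
residual : ∀ {n} → Fin n → Bool → VSet n → VSet n
residual x b S y = S y ∧ not (⌊ x ≟ y ⌋ ∧ b)

residual-keeps : ∀ {n} x b (S : VSet n) y → S y ≡ true → (y ≡ x → b ≡ false) → residual x b S y ≡ true
residual-keeps x b S y Sy h with x ≟ y
... | yes refl rewrite h refl | Sy = refl
... | no _ rewrite Sy = refl

Hit-child : ∀ {n} (G : Graph n) A S x b → A x ≡ nothing → ∀ σ →
  Hit G (A [ x ↦ b ]) (residual x b S) σ ≡ true → Hit G A S σ ≡ true × lookup σ x ≡ b
Hit-child G A S x b Ax σ h = ∧-true (∧-true (∧-true sat ext) one) unassigned , σx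
  where
  A' = A [ x ↦ b ]
  S' = residual x b S
  sol' = ∧-true₁ {Sol G A' σ} (∧-true₁ {Sol G A' σ ∧ allOneᵇ S' σ} h)
  one' = ∧-true₂ {Sol G A' σ} (∧-true₁ {Sol G A' σ ∧ allOneᵇ S' σ} h)
  unassigned' = ∧-true₂ {Sol G A' σ ∧ allOneᵇ S' σ} h
  sat = ∧-true₁ {satφ G σ} sol'
  ext' = ∧-true₂ {satφ G σ} sol'
  in-S' : ∀ y → S y ≡ true → y ≢ x → S' y ≡ true
  in-S' y Sy y≢x = residual-keeps x b S y Sy (λ e → ⊥-elim (y≢x e))
  σx : lookup σ x ≡ b
  σx = extends-elim A' σ ext' x b (update-same A x b)
  ext : extendsᵇ A σ ≡ true
  ext = extends-intro A σ agrees
    where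
    agrees : ∀ i c → A i ≡ just c → lookup σ i ≡ c
    agrees i c e with i ≟ x
    ... | yes refl with () ← trans (sym Ax) e
    ... | no i≢x = extends-elim A' σ ext' i c (trans (update-other A x b i i≢x) e)
  one : allOneᵇ S σ ≡ true
  one = allFin-intro _ λ y → ⇒-intro (S y) (one-at y)
    where
    one-at : ∀ y → S y ≡ true → lookup σ y ≡ true
    one-at y Sy with y ≟ x | bool-cases b
    ... | yes refl | inj₁ b-true = trans σx b-true
    ... | yes refl | inj₂ b-false =
      ⇒-elim (allFin-elim _ one' y) (residual-keeps x b S y Sy (λ _ → b-false))
    ... | no y≢x | _ = ⇒-elim (allFin-elim _ one' y) (in-S' y Sy y≢x)
  unassigned : unassignedOnᵇ A S ≡ true
  unassigned = allFin-intro _ λ y → ⇒-intro (S y) (unassigned-at y)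
    where
    unassigned-at : ∀ y → S y ≡ true → unassignedᵇ (A y) ≡ true
    unassigned-at y Sy with y ≟ x
    ... | yes refl rewrite Ax = refl
    ... | no y≢x = trans (cong unassignedᵇ (sym (update-other A x b y y≢x)))
                         (⇒-elim (allFin-elim _ unassigned' y) (in-S' y Sy y≢x))

#Hit-children : ∀ {n} (G : Graph n) A S x → A x ≡ nothing →
  # (Hit G (A [ x ↦ false ]) (residual x false S)) ℕ.+ # (Hit G (A [ x ↦ true ]) (residual x true S))
  ℕ.≤ # (Hit G A S)
#Hit-children G A S x Ax = begin
    # (Hit G (A [ x ↦ false ]) (residual x false S)) ℕ.+ # (Hit G (A [ x ↦ true ]) (residual x true S))
  ≤⟨ ℕP.+-mono-≤ (#-mono _ _ (into false)) (#-mono _ _ (into true)) ⟩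
    # (λ σ → Hit G A S σ ∧ (false ==B lookup σ x)) ℕ.+ # (λ σ → Hit G A S σ ∧ (true ==B lookup σ x))
  ≡⟨ ℕP.+-comm (# (λ σ → Hit G A S σ ∧ not (lookup σ x))) _ ⟩
    # (λ σ → Hit G A S σ ∧ lookup σ x) ℕ.+ # (λ σ → Hit G A S σ ∧ not (lookup σ x))
  ≡⟨ sym (#-split (Hit G A S) (λ σ → lookup σ x)) ⟩
    # (Hit G A S)
  ∎
  where
  open ℕP.≤-Reasoning
  into : ∀ b σ → Hit G (A [ x ↦ b ]) (residual x b S) σ ≡ true → Hit G A S σ ∧ (b ==B lookup σ x) ≡ true
  into b σ h with Hit-child G A S x b Ax σ h
  into true σ h | hit , σx = ∧-true hit σx
  into false σ h | hit , σx = ∧-true hit (not-true σx)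

sumℚ-++ : ∀ xs ys → sumℚ (xs ++ ys) ≡ sumℚ xs + sumℚ ys
sumℚ-++ [] ys = sym (ℚP.+-identityˡ _)
sumℚ-++ (x ∷ xs) ys = trans (cong (λ s → x + s) (sumℚ-++ xs ys)) (sym (ℚP.+-assoc x (sumℚ xs) (sumℚ ys)))

filterᵇ-++ : ∀ {a} {X : Set a} (p : X → Bool) xs ys → filterᵇ p (xs ++ ys) ≡ filterᵇ p xs ++ filterᵇ p ys
filterᵇ-++ p [] ys = refl
filterᵇ-++ p (x ∷ xs) ys with p x
... | true = cong (x ∷_) (filterᵇ-++ p xs ys)
... | false = filterᵇ-++ p xs ys

weightOf : ∀ {n} → Graph n → PartialAssignment n → VSet n → List (List (Literal n)) → ℚ
weightOf G A S Ps = sumℚ (map (pathWeight G A) (filterᵇ (positiveOnᵇ S) Ps))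

weightOf-++ : ∀ {n} (G : Graph n) A S Ps Qs → weightOf G A S (Ps ++ Qs) ≡ weightOf G A S Ps + weightOf G A S Qs
weightOf-++ G A S Ps Qs = begin
    sumℚ (map (pathWeight G A) (filterᵇ (positiveOnᵇ S) (Ps ++ Qs)))
  ≡⟨ cong (λ Rs → sumℚ (map (pathWeight G A) Rs)) (filterᵇ-++ (positiveOnᵇ S) Ps Qs) ⟩
    sumℚ (map (pathWeight G A) (filterᵇ (positiveOnᵇ S) Ps ++ filterᵇ (positiveOnᵇ S) Qs))
  ≡⟨ cong sumℚ (ListP.map-++ (pathWeight G A) (filterᵇ (positiveOnᵇ S) Ps) _) ⟩
    sumℚ (map (pathWeight G A) (filterᵇ (positiveOnᵇ S) Ps) ++ map (pathWeight G A) (filterᵇ (positiveOnᵇ S) Qs))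
  ≡⟨ sumℚ-++ (map (pathWeight G A) (filterᵇ (positiveOnᵇ S) Ps)) _ ⟩
    weightOf G A S Ps + weightOf G A S Qs
  ∎
  where open ≡-Reasoning

positiveOn-cons : ∀ {n} (S : VSet n) x b P → positiveOnᵇ S ((x , b) ∷ P) ≡ positiveOnᵇ (residual x b S) P
positiveOn-cons {n} S x b P = all-cong _ _ (allFin n) (λ y → implication (S y) (⌊ x ≟ y ⌋ ∧ b) _)
  where
  implication : ∀ s m r → not s ∨ (m ∨ r) ≡ not (s ∧ not m) ∨ r
  implication true true r = refl
  implication true false r = refl
  implication false m r = refl

weightOf-edge : ∀ {n} (G : Graph n) A S x b Ps →
  weightOf G A S (map ((x , b) ∷_) Ps) ≡
  ratio (count G (A [ x ↦ b ])) (count G A) * weightOf G (A [ x ↦ b ]) (residual x b S) Ps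
weightOf-edge G A S x b [] = sym (ℚP.*-zeroʳ (ratio (count G (A [ x ↦ b ])) (count G A)))
weightOf-edge G A S x b (P ∷ Ps) rewrite positiveOn-cons S x b P with positiveOnᵇ (residual x b S) P
... | true = trans (cong (λ w → pathWeight G A ((x , b) ∷ P) + w) (weightOf-edge G A S x b Ps))
                   (sym (ℚP.*-distribˡ-+ (ratio (count G (A [ x ↦ b ])) (count G A)) _ _))
... | false = weightOf-edge G A S x b Ps

positiveOn-[] : ∀ {n} (S : VSet n) → positiveOnᵇ S [] ≡ true → ∀ y → S y ≡ false
positiveOn-[] S h y = empty (S y) (allFin-elim _ h y)
  where
  empty : ∀ s → not s ∨ false ≡ true → s ≡ false
  empty false _ = refl

#Hit-∅ : ∀ {n} (G : Graph n) A (S : VSet n) → (∀ y → S y ≡ false) → # (Hit G A S) ≡ count G A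
#Hit-∅ {n} G A S S-empty = trans (#-cong _ _ all-hit) (sym (count≡#Sol G A))
  where
  vacuous : ∀ (v : Fin n → Bool) → all (λ y → not (S y) ∨ v y) (allFin n) ≡ true
  vacuous v = allFin-intro _ (λ y → ⇒-intro (S y) (λ Sy → ⊥-elim (true≢false Sy (S-empty y))))
  all-hit : ∀ σ → Hit G A S σ ≡ Sol G A σ
  all-hit σ rewrite vacuous (lookup σ) | vacuous (λ y → unassignedᵇ (A y)) =
    trans (BoolP.∧-identityʳ (Sol G A σ ∧ true)) (BoolP.∧-identityʳ (Sol G A σ))

-- The tree bound: below a vertex with literals A, the paths meeting S positively weigh at most
-- #Hit / #solutions.  (Weights telescope along edges; at every node the children share
-- the parent's Hit-solutions.)
mutual
  tree-bound : ∀ {n} (G : Graph n) A t → IsDT G A t → (IsNode t ⊎ 0 ℕ.< count G A) → ∀ S →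
    weightP G A t S ≤ ratio (# (Hit G A S)) (count G A)
  tree-bound G A leaf (leaf _) (inj₁ (_ , _ , _ , ())) S
  tree-bound G A leaf (leaf _) (inj₂ pos) S with positiveOnᵇ S [] in e
  ... | false = ratio-nonneg _ (count G A)
  ... | true = ℚP.≤-reflexive (begin
      1ℚ + 0ℚ                                 ≡⟨ ℚP.+-identityʳ 1ℚ ⟩
      1ℚ                                      ≡⟨ sym (ratio-self (count G A) pos) ⟩
      ratio (count G A) (count G A)           ≡⟨ cong (λ h → ratio h (count G A)) (sym (#Hit-∅ G A S (positiveOn-[] S e))) ⟩
      ratio (# (Hit G A S)) (count G A)       ∎)
    where open ≡-Reasoning
  tree-bound G A (node x c₀ c₁) (node Ax ok₀ ok₁) _ S = begin
      weightP G A (node x c₀ c₁) S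
    ≡⟨ weightOf-++ G A S (childPaths x false c₀) (childPaths x true c₁) ⟩
      weightOf G A S (childPaths x false c₀) + weightOf G A S (childPaths x true c₁)
    ≤⟨ ℚP.+-mono-≤ (child-bound G A S x false c₀ ok₀) (child-bound G A S x true c₁ ok₁) ⟩
      ratio H₀ (count G A) + ratio H₁ (count G A)
    ≡⟨ ratio-+ H₀ H₁ (count G A) ⟩
      ratio (H₀ ℕ.+ H₁) (count G A)
    ≤⟨ ratio-mono (count G A) (#Hit-children G A S x Ax) ⟩
      ratio (# (Hit G A S)) (count G A)
    ∎
    where
    open ℚP.≤-Reasoning
    H₀ = # (Hit G (A [ x ↦ false ]) (residual x false S))
    H₁ = # (Hit G (A [ x ↦ true ]) (residual x true S))

  child-bound : ∀ {n} (G : Graph n) A S x b c → ChildOK G A x b c →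
    weightOf G A S (childPaths x b c) ≤ ratio (# (Hit G (A [ x ↦ b ]) (residual x b S))) (count G A)
  child-bound G A S x b nothing (absent _) = ratio-nonneg _ (count G A)
  child-bound G A S x b (just t) (present pos dt) = begin
      weightOf G A S (map ((x , b) ∷_) (leafPaths t))
    ≡⟨ weightOf-edge G A S x b (leafPaths t) ⟩
      r * weightP G A' t S'
    ≤⟨ ℚP.*-monoˡ-≤-nonNeg r {{nonNegative (ratio-nonneg (count G A') (count G A))}}
                            (tree-bound G A' t dt (inj₂ pos) S') ⟩
      r * ratio (# (Hit G A' S')) (count G A')
    ≡⟨ ratio-telescope (# (Hit G A' S')) (count G A') (count G A) pos ⟩
      ratio (# (Hit G A' S')) (count G A)
    ∎
    where
    open ℚP.≤-Reasoning
    A' = A [ x ↦ b ]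
    S' = residual x b S
    r = ratio (count G A') (count G A)

present-IsDT : ∀ {n} {G : Graph n} {A x b c t} → ChildOK G A x b c → c ≡ just t → IsDT G (A [ x ↦ b ]) t
present-IsDT (present _ dt) refl = dt

reach-IsDT : ∀ {n} {G : Graph n} {A t A' u} → IsDT G A t → Reach A t A' u → IsDT G A' u
reach-IsDT dt here = dt
reach-IsDT (node _ ok₀ _) (step false eq r) = reach-IsDT (present-IsDT ok₀ eq) r
reach-IsDT (node _ _ ok₁) (step true eq r) = reach-IsDT (present-IsDT ok₁ eq) r

peel-bound : ∀ {n} (G : Graph n) A y → A y ≡ nothing → ¬ Forced G A y →
  (R : Assignment n → Bool) → (∀ σ τ → R σ ≡ true → AgreeOff G A y τ σ → R τ ≡ true) →
  ι (# (λ σ → (Sol G A σ ∧ R σ) ∧ lookup σ y)) ≤ c (Nsize G A y) * ι (# (λ σ → Sol G A σ ∧ R σ))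
peel-bound G A y y-unassigned y-unforced R R-ignores = begin
    ι a
  ≤⟨ c-bound a b d (Switching.switching-bound G A y y-unassigned y-unforced R R-ignores) ⟩
    c d * ι (a ℕ.+ b)
  ≡⟨ cong (λ k → c d * ι k) (sym (#-split (λ σ → Sol G A σ ∧ R σ) (λ σ → lookup σ y))) ⟩
    c d * ι (# (λ σ → Sol G A σ ∧ R σ))
  ∎
  where
  open ℚP.≤-Reasoning
  d = Nsize G A y
  a = # (λ σ → (Sol G A σ ∧ R σ) ∧ lookup σ y)
  b = # (λ σ → (Sol G A σ ∧ R σ) ∧ not (lookup σ y))

αOn : ∀ {n} → Graph n → PartialAssignment n → VSet n → List (Fin n) → ℚ
αOn G A S = foldr (λ y q → if S y then c (Nsize G A y) * q else q) 1ℚ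

αOn-nonneg : ∀ {n} (G : Graph n) A S ys → 0ℚ ≤ αOn G A S ys
αOn-nonneg G A S [] = ℚP.nonNegative⁻¹ 1ℚ
αOn-nonneg G A S (y ∷ ys) with S y
... | true = nonneg-* {c (Nsize G A y)} (c-nonneg (Nsize G A y)) (αOn-nonneg G A S ys)
... | false = αOn-nonneg G A S ys

allOneOnᵇ : ∀ {n} → VSet n → List (Fin n) → Assignment n → Bool
allOneOnᵇ S ys σ = all (λ y → not (S y) ∨ lookup σ y) ys

-- The remaining vertices of S are neither y nor neighbours of y, so the event
-- "the rest is 1" ignores N^A(y) ∪ {y}.
peel-all : ∀ {n} (G : Graph n) A S → Scattered G S → (∀ y → y ∈S S → ¬ Forced G A y) →
  (∀ y → y ∈S S → A y ≡ nothing) → ∀ ys → Unique ys →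
  ι (# (λ σ → Sol G A σ ∧ allOneOnᵇ S ys σ)) ≤ αOn G A S ys * ι (# (Sol G A))
peel-all G A S scattered unforced unassigned [] _ =
  ℚP.≤-reflexive (trans (cong ι (#-cong _ _ (λ σ → BoolP.∧-identityʳ (Sol G A σ))))
                        (sym (ℚP.*-identityˡ _)))
peel-all G A S scattered unforced unassigned (y ∷ ys) (y∉ys ∷ unique) with S y in y∈S
... | false = peel-all G A S scattered unforced unassigned ys unique
... | true = begin
    ι (# (λ σ → Sol G A σ ∧ (lookup σ y ∧ R σ)))
  ≡⟨ cong ι (#-cong _ _ (λ σ → reorder (Sol G A σ) (lookup σ y) (R σ))) ⟩
    ι (# (λ σ → (Sol G A σ ∧ R σ) ∧ lookup σ y))
  ≤⟨ peel-bound G A y (unassigned y y∈S) (unforced y y∈S) R R-ignores ⟩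
    c d * ι (# (λ σ → Sol G A σ ∧ R σ))
  ≤⟨ ℚP.*-monoˡ-≤-nonNeg (c d) {{nonNegative (c-nonneg d)}}
                         (peel-all G A S scattered unforced unassigned ys unique) ⟩
    c d * (αOn G A S ys * ι (# (Sol G A)))
  ≡⟨ sym (ℚP.*-assoc (c d) (αOn G A S ys) (ι (# (Sol G A)))) ⟩
    c d * αOn G A S ys * ι (# (Sol G A))
  ∎
  where
  open ℚP.≤-Reasoning
  d = Nsize G A y
  R : Assignment _ → Bool
  R = allOneOnᵇ S ys
  reorder : ∀ s v r → s ∧ (v ∧ r) ≡ (s ∧ r) ∧ v
  reorder true true r = sym (BoolP.∧-identityʳ r)
  reorder true false r = sym (BoolP.∧-zeroʳ r)
  reorder false v r = refl
  R-ignores : ∀ σ τ → R σ ≡ true → AgreeOff G A y τ σ → R τ ≡ true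
  R-ignores σ τ Rσ off = all-intro _ ys (λ y' m → ⇒-intro (S y') (one y' m))
    where
    one : ∀ y' → y' ∈ ys → S y' ≡ true → lookup τ y' ≡ true
    one y' m y'∈S = trans (off y' y'∉N y'≢y) (⇒-elim (all-elim _ Rσ m) y'∈S)
      where
      y'≢y : y' ≢ y
      y'≢y e = All.lookup y∉ys m (sym e)
      y'∉N : Nᵇ G A y y' ≡ false
      y'∉N with adj G y y' in yy'
      ... | true = ⊥-elim (proj₁ (scattered y y' y∈S y'∈S (λ e → y'≢y (sym e))) yy')
      ... | false = refl

hit-bound : ∀ {n} (G : Graph n) A S → Scattered G S → (∀ y → y ∈S S → ¬ Forced G A y) →
  ratio (# (Hit G A S)) (count G A) ≤ α G A S
hit-bound {n} G A S scattered unforced with count G A in count≡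
... | zero = αOn-nonneg G A S (allFin n)
... | suc k = ratio-≤ (# (Hit G A S)) k (α G A S) (bound (unassignedOnᵇ A S) refl)
  where
  bound : ∀ u → unassignedOnᵇ A S ≡ u → ι (# (Hit G A S)) ≤ α G A S * ι (suc k)
  bound false u≡ = subst (_≤ α G A S * ι (suc k)) (cong ι (sym no-hits))
                     (nonneg-* {α G A S} (αOn-nonneg G A S (allFin n)) (ι-mono {0} {suc k} ℕ.z≤n))
    where
    no-hits : # (Hit G A S) ≡ 0
    no-hits = trans (#-cong _ _ (λ σ → trans (cong ((Sol G A σ ∧ allOneᵇ S σ) ∧_) u≡) (BoolP.∧-zeroʳ _)))
                    (#-false {n})
  bound true u≡ = subst₂ (λ h m → ι h ≤ α G A S * ι m) (sym hits) (trans (sym (count≡#Sol G A)) count≡)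
    (peel-all G A S scattered unforced unassigned (allFin n) (allFin⁺ n))
    where
    unassigned : ∀ y → y ∈S S → A y ≡ nothing
    unassigned y y∈S with A y | ⇒-elim (allFin-elim _ u≡ y) y∈S
    ... | nothing | _ = refl
    hits : # (Hit G A S) ≡ # (λ σ → Sol G A σ ∧ allOneOnᵇ S (allFin n) σ)
    hits = #-cong _ _ (λ σ → trans (cong ((Sol G A σ ∧ allOneᵇ S σ) ∧_) u≡) (BoolP.∧-identityʳ _))

theorem6 : ∀ {n : ℕ} (G : Graph n) → NoIsolated G →
    (T : DTree n) → IsDecisionTree G T →
    ∀ (Aᵤ : PartialAssignment n) (u : DTree n) → Reach ∅ T Aᵤ u → IsNode u →
    (S : VSet n) → Scattered G S → (∀ y → y ∈S S → ¬ Forced G Aᵤ y) →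
    weightP G Aᵤ u S ≤ α G Aᵤ S
theorem6 G _ T (T-isDT , _) Aᵤ u reach u-node S scattered unforced = begin
    weightP G Aᵤ u S
  ≤⟨ tree-bound G Aᵤ u (reach-IsDT T-isDT reach) (inj₁ u-node) S ⟩
    ratio (# (Hit G Aᵤ S)) (count G Aᵤ)
  ≤⟨ hit-bound G Aᵤ S scattered unforced ⟩
    α G Aᵤ S
  ∎
  where open ℚP.≤-Reasoning
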